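{- Let $\ell \geq 1$ be an integer and let $G \in ER(n,d,3+\ell)$ have a uniform shared neighborhood structure. Then this uniform shared neighborhood structure is not isomorphic to $P_3 + \ell K_1$.
   Context: For a finite simple graph $G$, $N(u)$ is the open neighborhood of a vertex $u$. $G \in ER(n,d,\lambda)$ means $G$ has $n$ vertices, is $d$-regular, and every pair of adjacent vertices has exactly $\lambda$ common neighbors. $G$ has a uniform shared neighborhood structure isomorphic to $H$ if the induced subgraph $G[N(u)\cap N(v)]$ is isomorphic to $H$ for all adjacent $u,v$. $A+B$ denotes the disjoint union of graphs, $\ell K_1$ is the edgeless graph on $\ell$ vertices, and $P_3$ is the path on $3$ vertices. -}

module Defs where

open import Data.Nat using (ℕ; zero; suc; _+_)
open import Data.Fin using (Fin; zero; suc)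
open import Data.Bool using (Bool; true; false; _∧_)
open import Data.List using (List; filter; length)
open import Data.List using () renaming (allFin to allFinL)
open import Data.Product using (Σ; _×_; _,_; ∃)
open import Relation.Binary.PropositionalEquality using (_≡_; _≢_)
open import Relation.Nullary using (¬_)
open import Relation.Nullary.Decidable using (⌊_⌋)
open import Data.Bool.Properties using () renaming (_≟_ to _≟B_)
open import Function.Definitions using (Injective)

record Graph (n : ℕ) : Set where
  field
    adj   : Fin n → Fin n → Bool
    sym   : ∀ u v → adj u v ≡ adj v u
    irref : ∀ u → adj u u ≡ false
open Graph public

Adj : ∀ {n} → Graph n → Fin n → Fin n → Set
Adj G u v = adj G u v ≡ true

count : ∀ {n} → (Fin n → Bool) → ℕ
count {n} p = length (filter (λ w → p w ≟B true) (allFinL n))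

degree : ∀ {n} → Graph n → Fin n → ℕ
degree G u = count (adj G u)

common : ∀ {n} → Graph n → Fin n → Fin n → Fin n → Bool
common G u v w = adj G u w ∧ adj G v w

IsER : (n d λ' : ℕ) → Graph n → Set
IsER n d λ' G =
  (∀ u → degree G u ≡ d) ×
  (∀ u v → Adj G u v → count (common G u v) ≡ λ')

-- The induced subgraph G[N(u) ∩ N(v)] is isomorphic to H:
-- an injective map f : Fin m → Fin n whose image is exactly N(u) ∩ N(v)
-- and which preserves and reflects adjacency.
SharedNbhdIso : ∀ {n m} → Graph n → Fin n → Fin n → Graph m → Set
SharedNbhdIso {n} {m} G u v H =
  Σ (Fin m → Fin n) λ f →
    Injective _≡_ _≡_ f ×
    (∀ w → common G u v w ≡ true → ∃ λ x → f x ≡ w) ×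
    (∀ x → common G u v (f x) ≡ true) ×
    (∀ x y → adj H x y ≡ adj G (f x) (f y))

UniformShared : ∀ {n m} → Graph n → Graph m → Set
UniformShared G H = ∀ u v → Adj G u v → SharedNbhdIso G u v H

-- The graph P₃ + ℓ K₁ on vertex set Fin (3 + ℓ):
-- vertices 0,1,2 form the path 0 - 1 - 2, the remaining ℓ are isolated.
p3adj : ∀ {ℓ} → Fin (3 + ℓ) → Fin (3 + ℓ) → Bool
p3adj zero (suc zero) = true
p3adj (suc zero) zero = true
p3adj (suc zero) (suc (suc zero)) = true
p3adj (suc (suc zero)) (suc zero) = true
p3adj _ _ = false

P3+ℓK1 : (ℓ : ℕ) → Graph (3 + ℓ)
P3+ℓK1 ℓ = record { adj = p3adj ; sym = s ; irref = i }
  where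
  s : ∀ u v → p3adj {ℓ} u v ≡ p3adj v u
  s zero zero = _≡_.refl
  s zero (suc zero) = _≡_.refl
  s zero (suc (suc zero)) = _≡_.refl
  s zero (suc (suc (suc v))) = _≡_.refl
  s (suc zero) zero = _≡_.refl
  s (suc zero) (suc zero) = _≡_.refl
  s (suc zero) (suc (suc zero)) = _≡_.refl
  s (suc zero) (suc (suc (suc v))) = _≡_.refl
  s (suc (suc zero)) zero = _≡_.refl
  s (suc (suc zero)) (suc zero) = _≡_.refl
  s (suc (suc zero)) (suc (suc zero)) = _≡_.refl
  s (suc (suc zero)) (suc (suc (suc v))) = _≡_.refl
  s (suc (suc (suc u))) zero = _≡_.refl
  s (suc (suc (suc u))) (suc zero) = _≡_.refl
  s (suc (suc (suc u))) (suc (suc zero)) = _≡_.refl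
  s (suc (suc (suc u))) (suc (suc (suc v))) = _≡_.refl
  i : ∀ u → p3adj {ℓ} u u ≡ false
  i zero = _≡_.refl
  i (suc zero) = _≡_.refl
  i (suc (suc zero)) = _≡_.refl
  i (suc (suc (suc u))) = _≡_.refl

{-# OPTIONS --safe #-}
module Submission where

open import Defs hiding (sym)
open import Data.Nat using (ℕ; _+_; _≤_)
open import Data.Fin using (Fin; zero; suc; _≟_)
open import Data.Product using (∃; ∃₂; _×_; _,_; proj₁; proj₂)
open import Data.Sum using (_⊎_; inj₁; inj₂)
open import Data.Bool using (true; _∧_)
open import Data.Empty using (⊥-elim)
open import Relation.Nullary using (¬_; yes; no)
open import Relation.Binary.PropositionalEquality
  using (_≡_; _≢_; refl; sym; trans; cong; subst; subst₂)

-- Let uv be an edge and a — b a leaf and the centre of the path P₃ in N(u) ∩ N(v).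
-- In the structure of the edge ua the adjacent pair v, b must contain the centre.
-- It cannot be v: the ends of that path would be common neighbours of u, v and a,
-- hence both equal to b, the only neighbour of the leaf a in N(u) ∩ N(v). So b is
-- the centre, and an end w ≠ v of that path lies in N(a) ∩ N(b) ∩ N(u). Thus u has
-- the two distinct neighbours v, w in N(a) ∩ N(b), and is the centre of the
-- structure of the edge ab. Exchanging u and v leaves a and b unchanged, so v is
-- that centre as well, and u = v is absurd.

∧-≡-true⁻ : ∀ {x y} → x ∧ y ≡ true → x ≡ true × y ≡ true
∧-≡-true⁻ {true} y≡true = refl , y≡true

∧-≡-true⁺ : ∀ {x y} → x ≡ true → y ≡ true → x ∧ y ≡ true
∧-≡-true⁺ refl y≡true = y≡true

pattern left   = zero
pattern middle = suc zero
pattern right  = suc (suc zero)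

p3adj-middle : ∀ {ℓ} (x y : Fin (3 + ℓ)) → p3adj x y ≡ true → x ≡ middle ⊎ y ≡ middle
p3adj-middle middle _      _  = inj₁ refl
p3adj-middle left   middle _  = inj₂ refl
p3adj-middle right  middle _  = inj₂ refl
p3adj-middle left   left   ()
p3adj-middle left   (suc (suc _)) ()
p3adj-middle right  left   ()
p3adj-middle right  (suc (suc _)) ()
p3adj-middle (suc (suc (suc _))) _ ()

p3adj-left : ∀ {ℓ} (y : Fin (3 + ℓ)) → p3adj left y ≡ true → y ≡ middle
p3adj-left y e with p3adj-middle left y e
... | inj₂ y≡middle = y≡middle

p3adj-cherry : ∀ {ℓ} (x y z : Fin (3 + ℓ)) → p3adj x y ≡ true → p3adj x z ≡ true →
               y ≢ z → x ≡ middle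
p3adj-cherry x y z xy xz y≢z with p3adj-middle x y xy | p3adj-middle x z xz
... | inj₁ x≡middle | _              = x≡middle
... | _             | inj₁ x≡middle  = x≡middle
... | inj₂ y≡middle | inj₂ z≡middle  = ⊥-elim (y≢z (trans y≡middle (sym z≡middle)))

module _ {n : ℕ} (G : Graph n) where

  Adj-sym : ∀ {u v} → Adj G u v → Adj G v u
  Adj-sym {u} {v} uv = trans (Graph.sym G v u) uv

  Adj-irrefl : ∀ {u} → ¬ Adj G u u
  Adj-irrefl {u} uu with trans (sym uu) (irref G u)
  ... | ()

  common⁺ : ∀ {u v w} → Adj G u w → Adj G v w → common G u v w ≡ true
  common⁺ = ∧-≡-true⁺

  common⁻ˡ : ∀ {u v w} → common G u v w ≡ true → Adj G u w
  common⁻ˡ c = proj₁ (∧-≡-true⁻ c)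

  common⁻ʳ : ∀ {u v w} → common G u v w ≡ true → Adj G v w
  common⁻ʳ c = proj₂ (∧-≡-true⁻ c)

  common-comm : ∀ {u v w} → common G u v w ≡ true → common G v u w ≡ true
  common-comm c = common⁺ (common⁻ʳ c) (common⁻ˡ c)

  SharedNbhdIso-swap : ∀ {m u v} {H : Graph m} → SharedNbhdIso G u v H → SharedNbhdIso G v u H
  SharedNbhdIso-swap (f , f-inj , onto , into , adj-f) =
    f , f-inj , (λ w c → onto w (common-comm c)) , (λ x → common-comm (into x)) , adj-f

  module SharedNbhd {m} {u v : Fin n} {H : Graph m} (F : SharedNbhdIso G u v H) where

    embed : Fin m → Fin n
    embed = proj₁ F

    embed-injective : ∀ {x y} → embed x ≡ embed y → x ≡ y
    embed-injective = proj₁ (proj₂ F)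

    embed-common : ∀ x → common G u v (embed x) ≡ true
    embed-common = proj₁ (proj₂ (proj₂ (proj₂ F)))

    adj-embed : ∀ x y → adj H x y ≡ adj G (embed x) (embed y)
    adj-embed = proj₂ (proj₂ (proj₂ (proj₂ F)))

    module _ {w : Fin n} (c : common G u v w ≡ true) where

      preimage : Fin m
      preimage = proj₁ (proj₁ (proj₂ (proj₂ F)) w c)

      embed-preimage : embed preimage ≡ w
      embed-preimage = proj₂ (proj₁ (proj₂ (proj₂ F)) w c)

    adj-reflect : ∀ x y → Adj G (embed x) (embed y) → adj H x y ≡ true
    adj-reflect x y = trans (adj-embed x y)

    adj-preimage : ∀ {w w′} (c : common G u v w ≡ true) (c′ : common G u v w′ ≡ true) →
                   Adj G w w′ → adj H (preimage c) (preimage c′) ≡ true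
    adj-preimage c c′ ww′ = adj-reflect (preimage c) (preimage c′)
      (subst₂ (Adj G) (sym (embed-preimage c)) (sym (embed-preimage c′)) ww′)

  module SharedP3 {ℓ} {u v : Fin n} (F : SharedNbhdIso G u v (P3+ℓK1 ℓ)) where

    open SharedNbhd {H = P3+ℓK1 ℓ} F

    leaf centre : Fin n
    leaf   = embed left
    centre = embed middle

    leaf-common : common G u v leaf ≡ true
    leaf-common = embed-common left

    centre-common : common G u v centre ≡ true
    centre-common = embed-common middle

    leaf-adj-centre : Adj G leaf centre
    leaf-adj-centre = sym (adj-embed left middle)

    private
      preimage-middle : ∀ {w} (c : common G u v w ≡ true) → preimage c ≡ middle → w ≡ centre
      preimage-middle c p≡middle = trans (sym (embed-preimage c)) (cong embed p≡middle)

    common-edge-centre : ∀ {w w′} (c : common G u v w ≡ true) (c′ : common G u v w′ ≡ true) →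
                         Adj G w w′ → w ≡ centre ⊎ w′ ≡ centre
    common-edge-centre c c′ ww′ with p3adj-middle _ _ (adj-preimage c c′ ww′)
    ... | inj₁ p≡middle = inj₁ (preimage-middle c p≡middle)
    ... | inj₂ p≡middle = inj₂ (preimage-middle c′ p≡middle)

    common-cherry-centre : ∀ {w w₁ w₂} (c : common G u v w ≡ true)
                           (c₁ : common G u v w₁ ≡ true) (c₂ : common G u v w₂ ≡ true) →
                           Adj G w w₁ → Adj G w w₂ → w₁ ≢ w₂ → w ≡ centre
    common-cherry-centre c c₁ c₂ ww₁ ww₂ w₁≢w₂ = preimage-middle c
      (p3adj-cherry _ _ _ (adj-preimage c c₁ ww₁) (adj-preimage c c₂ ww₂) p₁≢p₂)
      where
      p₁≢p₂ : preimage c₁ ≢ preimage c₂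
      p₁≢p₂ p₁≡p₂ = w₁≢w₂ (trans (sym (embed-preimage c₁))
                            (trans (cong embed p₁≡p₂) (embed-preimage c₂)))

    common-leaf-neighbour : ∀ {w} (c : common G u v w ≡ true) → Adj G leaf w → w ≡ centre
    common-leaf-neighbour c leaf-w = preimage-middle c
      (p3adj-left _ (adj-reflect left (preimage c)
        (subst (Adj G leaf) (sym (embed-preimage c)) leaf-w)))

    centre-neighbour-avoiding : ∀ z → ∃ λ w → common G u v w ≡ true × Adj G centre w × w ≢ z
    centre-neighbour-avoiding z with embed left ≟ z
    ... | no  left≢z = embed left , embed-common left , sym (adj-embed middle left) , left≢z
    ... | yes left≡z = embed right , embed-common right , sym (adj-embed middle right) ,
                       λ right≡z → left≢right (embed-injective (trans left≡z (sym right≡z)))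
      where
      left≢right : left ≢ right
      left≢right ()

  module _ {ℓ} (shared : UniformShared G (P3+ℓK1 ℓ)) where

    open SharedP3 using (leaf; centre)

    endpoint≡leaf-edge-centre : ∀ {u v} → Adj G u v → (F : SharedNbhdIso G u v (P3+ℓK1 ℓ)) →
                                (K : SharedNbhdIso G (leaf F) (centre F) (P3+ℓK1 ℓ)) → u ≡ centre K
    endpoint≡leaf-edge-centre {u} {v} uv F K = u≡K-centre
      where
      open SharedP3 F using (leaf-common; centre-common; leaf-adj-centre; common-leaf-neighbour)
      a b : Fin n
      a = leaf F
      b = centre F

      ua : Adj G u a
      ua = common⁻ˡ leaf-common
      va : Adj G v a
      va = common⁻ʳ leaf-common
      ub : Adj G u b
      ub = common⁻ˡ centre-common
      vb : Adj G v b
      vb = common⁻ʳ centre-common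

      module UA = SharedP3 (shared u a ua)
      module K = SharedP3 K

      b≡UA-centre : b ≡ UA.centre
      b≡UA-centre
        with UA.common-edge-centre (common⁺ uv (Adj-sym va)) (common⁺ ub leaf-adj-centre) vb
      ... | inj₂ b≡UA-centre = b≡UA-centre
      ... | inj₁ v≡UA-centre with UA.centre-neighbour-avoiding b
      ...   | w , w∈UA , UA-centre-w , w≢b =
        ⊥-elim (w≢b (common-leaf-neighbour (common⁺ (common⁻ˡ w∈UA) vw) (common⁻ʳ w∈UA)))
        where
        vw : Adj G v w
        vw = subst (λ s → Adj G s w) (sym v≡UA-centre) UA-centre-w

      u≡K-centre : u ≡ K.centre
      u≡K-centre with UA.centre-neighbour-avoiding v
      ... | w , w∈UA , UA-centre-w , w≢v =
        K.common-cherry-centre (common⁺ (Adj-sym ua) (Adj-sym ub))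
                               (common⁺ (Adj-sym va) (Adj-sym vb))
                               (common⁺ (common⁻ʳ w∈UA) bw)
                               uv (common⁻ˡ w∈UA) (λ v≡w → w≢v (sym v≡w))
        where
        bw : Adj G b w
        bw = subst (λ s → Adj G s w) (sym b≡UA-centre) UA-centre-w

corollary1 : (ℓ n d : ℕ) → 1 ≤ ℓ → (G : Graph n) → IsER n d (3 + ℓ) G
    → ∃₂ (λ u v → Adj G u v)
    → ¬ UniformShared G (P3+ℓK1 ℓ)
corollary1 ℓ n d _ G _ (u , v , uv) shared = Adj-irrefl G (subst (Adj G u) v≡u uv)
  where
  open SharedP3 G using (leaf; centre; leaf-adj-centre)
  F : SharedNbhdIso G u v (P3+ℓK1 ℓ)
  F = shared u v uv
  K : SharedNbhdIso G (leaf F) (centre F) (P3+ℓK1 ℓ)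
  K = shared (leaf F) (centre F) (leaf-adj-centre F)
  v≡u : v ≡ u
  v≡u = trans (endpoint≡leaf-edge-centre G shared (Adj-sym G uv) F′ K)
              (sym (endpoint≡leaf-edge-centre G shared uv F K))
    where
    F′ : SharedNbhdIso G v u (P3+ℓK1 ℓ)
    F′ = SharedNbhdIso-swap G {H = P3+ℓK1 ℓ} F
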